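{- Let $n\ge2$. If $p\in S_m$ avoids the pattern $321$, then there are only finitely many $\omega\in\widetilde{S}_n$ that avoid $p$.
   Context: For $n\ge1$, the affine symmetric group $\widetilde{S}_n$ is the set of all bijections $\omega:\mathbb{Z}\to\mathbb{Z}$ with $\omega(i+n)=\omega(i)+n$ for all $i\in\mathbb{Z}$ and $\sum_{i=1}^n\omega(i)=\binom{n+1}{2}$; write $\omega_i=\omega(i)$. For $p\in S_k$, $\omega$ contains $p$ if there are integers $i_1<\cdots<i_k$ such that $\omega_{i_1}\cdots\omega_{i_k}$ has the same relative order as $p_1\cdots p_k$; otherwise $\omega$ avoids $p$. A permutation avoids $321$ if there are no $a<b<c$ with $p_a>p_b>p_c$. -}

module Defs where

open import Data.Nat using (ℕ; zero; suc)
open import Data.Nat.Combinatorics using (_C_)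
open import Data.Integer using (ℤ; +_; _+_; _<_)
open import Data.Fin using (Fin)
import Data.Fin as F
open import Data.Fin.Permutation using (Permutation′; _⟨$⟩ʳ_)
open import Data.Product using (Σ; _×_; ∃)
open import Data.List using (List)
open import Data.List.Relation.Unary.Any using (Any)
open import Function.Definitions using (Bijective)
open import Function.Bundles using (_⇔_)
open import Relation.Binary.PropositionalEquality using (_≡_)
open import Relation.Nullary using (¬_)

windowSum : (ℤ → ℤ) → ℕ → ℤ
windowSum ω zero    = + 0
windowSum ω (suc k) = windowSum ω k + ω (+ (suc k))

record IsAffinePerm (n : ℕ) (ω : ℤ → ℤ) : Set where
  field
    bijective : Bijective _≡_ _≡_ ω
    periodic  : ∀ i → ω (i + + n) ≡ ω i + + n
    windowSum≡ : windowSum ω n ≡ + (suc n C 2)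

Contains : {m : ℕ} → (ℤ → ℤ) → Permutation′ m → Set
Contains {m} ω p =
  Σ (Fin m → ℤ) λ idx →
    (∀ a b → a F.< b → idx a < idx b) ×
    (∀ a b → (ω (idx a) < ω (idx b)) ⇔ ((p ⟨$⟩ʳ a) F.< (p ⟨$⟩ʳ b)))

Avoids : {m : ℕ} → (ℤ → ℤ) → Permutation′ m → Set
Avoids ω p = ¬ Contains ω p

Avoids321 : {m : ℕ} → Permutation′ m → Set
Avoids321 {m} p = ∀ (a b c : Fin m) → a F.< b → b F.< c →
  ¬ (((p ⟨$⟩ʳ b) F.< (p ⟨$⟩ʳ a)) × ((p ⟨$⟩ʳ c) F.< (p ⟨$⟩ʳ b)))

FiniteFunSet : ((ℤ → ℤ) → Set) → Set
FiniteFunSet P = ∃ λ (L : List (ℤ → ℤ)) →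
  ∀ ω → P ω → Any (λ g → ∀ i → ω i ≡ g i) L

module Submission where

open import Defs
open import Data.Nat using (ℕ; _≥_; NonZero; >-nonZero; z<s)
open import Data.Nat.Properties using (<-≤-trans)
open import Data.Product using (_×_)
open import Data.Fin.Permutation using (Permutation′)

-- Write ω(x) = x + d(x): the displacement d is n-periodic and sums to 0 over
-- a window, so it takes values ≤ 0 and ≥ 0 at some residues.  If d were large
-- at some residue, two residues would have displacements far apart, giving
-- positions x < y < x + n with ω(x) = ω(y) + E for a huge E.  The strands
-- x + t*n and y + t*n carry the values ω(x) + t*n and ω(x) - E + t*n.  A
-- 321-avoiding p is the union of two increasing chains (its left-to-right
-- maxima and the rest); placing the upper chain on the first strand and the
-- lower chain on the second, at well chosen blocks t, realises p.  Hence an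
-- avoider has |d| ≤ B on the residues, and ω is x ↦ x + d(x mod n) for one of
-- the finitely many vectors (d(0), …, d(n-1)) ∈ [-B, B]^n.

module TwoChainSchedules where

  open import Data.Nat
  open import Data.Nat.Properties
  open import Data.Nat.Induction using (<-rec)
  open import Data.Nat.Tactic.RingSolver using (solve-∀)
  open import Data.Bool as Bool using (Bool; true; false; if_then_else_)
  open import Data.Product using (∃; _×_; _,_; map₂; map₁)
  open import Data.Sum using (_⊎_; inj₁; inj₂)
  open import Data.Empty using (⊥-elim)
  open import Relation.Binary.Definitions using (tri<; tri≈; tri>)
  open import Function.Base using (_$_)
  open import Function.Bundles using (_⇔_; mk⇔)
  open import Relation.Nullary using (Dec; yes; no; does; ¬_)
  open import Relation.Nullary.Decidable using (dec-true; dec-false; does-⇔; _×-dec_)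
  open import Relation.Binary.PropositionalEquality

  -- Course-of-values recursion: the value at k may depend on all earlier
  -- values.  `table k` is correct below k; the fixpoint reads the diagonal.
  module CourseOfValues (step : (ℕ → ℕ) → ℕ → ℕ) where

    Local : Set
    Local = ∀ f g k → (∀ j → j < k → f j ≡ g j) → step f k ≡ step g k

    table : ℕ → ℕ → ℕ
    table zero    j = 0
    table (suc k) j with j <? k
    ... | yes _ = table k j
    ... | no  _ = step (table k) k

    opaque
      fixpoint : ℕ → ℕ
      fixpoint k = table (suc k) k

    table-diagonal : ∀ k → table (suc k) k ≡ step (table k) k
    table-diagonal k with k <? k
    ... | yes k<k = ⊥-elim (<-irrefl refl k<k)
    ... | no  _   = refl

    module _ (local : Local) where

      opaque
        unfolding fixpoint

        table-correct : ∀ k j → j < k → table k j ≡ fixpoint j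
        table-correct (suc k) j j<1+k with j <? k
        ... | yes j<k = table-correct k j j<k
        ... | no  j≮k rewrite ≤-antisym (s≤s⁻¹ j<1+k) (≮⇒≥ j≮k) = sym (table-diagonal k)

        unfold : ∀ k → fixpoint k ≡ step fixpoint k
        unfold k = trans (table-diagonal k) (local (table k) fixpoint k (table-correct k))

  maxBelow : ℕ → (ℕ → ℕ) → ℕ
  maxBelow zero    f = 0
  maxBelow (suc k) f = f k ⊔ maxBelow k f

  maxBelow-upper : ∀ {j k} f → j < k → f j ≤ maxBelow k f
  maxBelow-upper {j} {suc k} f j<1+k with m<1+n⇒m<n∨m≡n j<1+k
  ... | inj₁ j<k  = ≤-trans (maxBelow-upper f j<k) (m≤n⊔m (f k) (maxBelow k f))
  ... | inj₂ refl = m≤m⊔n (f j) (maxBelow k f)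

  maxBelow-least : ∀ k f {c B} → (∀ j → j < k → f j + c ≤ B) → c ≤ B → maxBelow k f + c ≤ B
  maxBelow-least zero    f h c≤B = c≤B
  maxBelow-least (suc k) f {c} h c≤B
    rewrite +-distribʳ-⊔ c (f k) (maxBelow k f) =
    ⊔-lub (h k ≤-refl) (maxBelow-least k f (λ j j<k → h j (m<n⇒m<1+n j<k)) c≤B)

  maxBelow-cong : ∀ k {f g} → (∀ j → j < k → f j ≡ g j) → maxBelow k f ≡ maxBelow k g
  maxBelow-cong zero    agree = refl
  maxBelow-cong (suc k) agree =
    cong₂ _⊔_ (agree k ≤-refl) (maxBelow-cong k (λ j j<k → agree j (m<n⇒m<1+n j<k)))

  <-by-summands : ∀ {a b c d} → a + c ≤ b + d → d < c → a < b
  <-by-summands a+c≤b+d d<c = ≰⇒> (λ b≤a → <⇒≱ (+-mono-≤-< b≤a d<c) a+c≤b+d)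

  -- For
  -- every large e we produce increasing times such that an upper entry j and a
  -- later lower entry k satisfy  time k ≤ time j + e  exactly when v k < v j.
  -- The time of k is  e * level k + offset k : levels take care of pairs whose
  -- answer is forced, offsets (much smaller than e) of the remaining pairs.
  module TwoChains
    (m : ℕ) (v : ℕ → ℕ) (up : ℕ → Bool)
    (v-injective : ∀ {j k} → j < m → k < m → v j ≡ v k → j ≡ k)
    (upper-increasing : ∀ {j k} → j < k → k < m → up j ≡ true → up k ≡ true → v j < v k)
    (lower-increasing : ∀ {j k} → j < k → k < m → up j ≡ false → up k ≡ false → v j < v k)
    where

    Upper Lower : ℕ → Set
    Upper k = up k ≡ true
    Lower k = up k ≡ false

    lower-increasing-≤ : ∀ {i k} → i ≤ k → k < m → Lower i → Lower k → v i ≤ v k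
    lower-increasing-≤ i≤k k<m li lk with m≤n⇒m<n∨m≡n i≤k
    ... | inj₁ i<k  = <⇒≤ (lower-increasing i<k k<m li lk)
    ... | inj₂ refl = ≤-refl

    distinct : ∀ {j k} → j < m → k < m → j ≢ k → v j ≤ v k → v j < v k
    distinct j<m k<m j≢k le = ≤∧≢⇒< le (λ e → j≢k (v-injective j<m k<m e))

    -- Levels.  A new level starts at a lower entry k+1 lying above an upper
    -- entry of the current level; so inside a level every lower entry lies
    -- below every earlier upper entry.
    OpensLevel : (ℕ → ℕ) → ℕ → Set
    OpensLevel f k = Lower (suc k) × ∃ λ j → j < suc k × (Upper j × f j ≡ f k × v j < v (suc k))

    opensLevel? : ∀ f k → Dec (OpensLevel f k)
    opensLevel? f k = (up (suc k) Bool.≟ false) ×-dec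
      anyUpTo? (λ j → (up j Bool.≟ true) ×-dec (f j ≟ f k) ×-dec (v j <? v (suc k))) (suc k)

    opensLevel-transport : ∀ {f g} k → (∀ j → j < suc k → f j ≡ g j) → OpensLevel f k → OpensLevel g k
    opensLevel-transport k agree (lower , j , j<1+k , upper , same , above) =
      lower , j , j<1+k , upper , trans (sym (agree j j<1+k)) (trans same (agree k ≤-refl)) , above

    levelStep : (ℕ → ℕ) → ℕ → ℕ
    levelStep f zero    = 0
    levelStep f (suc k) = if does (opensLevel? f k) then suc (f k) else f k

    levelStep-local : CourseOfValues.Local levelStep
    levelStep-local f g zero    agree = refl
    levelStep-local f g (suc k) agree =
      cong₂ (λ b x → if b then suc x else x)
        (does-⇔ (mk⇔ (opensLevel-transport k agree) (opensLevel-transport k (λ j j<k → sym (agree j j<k))))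
                (opensLevel? f k) (opensLevel? g k))
        (agree k ≤-refl)

    level : ℕ → ℕ
    level = CourseOfValues.fixpoint levelStep

    level-unfold : ∀ k → level k ≡ levelStep level k
    level-unfold = CourseOfValues.unfold levelStep levelStep-local

    level-opens : ∀ k → OpensLevel level k → level (suc k) ≡ suc (level k)
    level-opens k o = trans (level-unfold (suc k))
      (cong (λ b → if b then suc (level k) else level k) (dec-true (opensLevel? level k) o))

    level-stays : ∀ k → ¬ OpensLevel level k → level (suc k) ≡ level k
    level-stays k ¬o = trans (level-unfold (suc k))
      (cong (λ b → if b then suc (level k) else level k) (dec-false (opensLevel? level k) ¬o))

    level-suc : ∀ k → level k ≤ level (suc k)
    level-suc k with opensLevel? level k
    ... | yes o  = subst (level k ≤_) (sym (level-opens k o)) (n≤1+n (level k))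
    ... | no  ¬o = ≤-reflexive (sym (level-stays k ¬o))

    level-mono : ∀ {j k} → j ≤ k → level j ≤ level k
    level-mono {k = zero}  z≤n = ≤-refl
    level-mono {k = suc k} j≤1+k with m≤n⇒m<n∨m≡n j≤1+k
    ... | inj₁ j<1+k = ≤-trans (level-mono (s≤s⁻¹ j<1+k)) (level-suc k)
    ... | inj₂ refl  = ≤-refl

    level-reflects-< : ∀ {j k} → level j < level k → j < k
    level-reflects-< lj<lk = ≰⇒> (λ k≤j → <⇒≱ lj<lk (level-mono k≤j))

    level-≤ : ∀ k → level k ≤ k
    level-≤ zero    = ≤-reflexive (level-unfold 0)
    level-≤ (suc k) with opensLevel? level k
    ... | yes o  = subst (_≤ suc k) (sym (level-opens k o)) (s≤s (level-≤ k))
    ... | no  ¬o = subst (_≤ suc k) (sym (level-stays k ¬o)) (m≤n⇒m≤1+n (level-≤ k))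

    level-crossing : ∀ c k → c < level k → ∃ λ k′ → suc k′ ≤ k × OpensLevel level k′ × level k′ ≡ c
    level-crossing c zero    c<l = ⊥-elim (n≮0 (subst (c <_) (level-unfold 0) c<l))
    level-crossing c (suc k) c<l with opensLevel? level k
    ... | no ¬o = map₂ (map₁ m≤n⇒m≤1+n) (level-crossing c k (subst (c <_) (level-stays k ¬o) c<l))
    ... | yes o with m<1+n⇒m<n∨m≡n (subst (c <_) (level-opens k o) c<l)
    ...   | inj₁ c<lk = map₂ (map₁ m≤n⇒m≤1+n) (level-crossing c k c<lk)
    ...   | inj₂ refl = k , ≤-refl , o , refl

    sameLevel-descent : ∀ {j k} → j < k → k < m → Upper j → Lower k → level j ≡ level k → v k < v j
    sameLevel-descent {k = zero}  ()
    sameLevel-descent {j} {suc k} j<1+k 1+k<m upper lower same =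
      distinct 1+k<m j<m (λ e → <-irrefl (sym e) j<1+k) (≮⇒≥ not-above)
      where
      j<m : j < m
      j<m = <-trans j<1+k 1+k<m
      stays : level k ≡ level (suc k)
      stays = ≤-antisym (level-suc k) (subst (_≤ level k) same (level-mono (s≤s⁻¹ j<1+k)))
      not-above : ¬ (v j < v (suc k))
      not-above above = 1+n≢n (sym (trans stays (level-opens k opening)))
        where
        opening : OpensLevel level k
        opening = lower , j , j<1+k , upper , trans same (sym stays) , above

    farLevel-ascent : ∀ {j k} → j < k → k < m → Upper j → Lower k → 2 + level j ≤ level k → v j < v k
    farLevel-ascent {j} {k} j<k k<m upper lower far
      with level-crossing (suc (level j)) k far
    ... | k′ , 1+k′≤k , (lower′ , j′ , j′<1+k′ , upper′ , same , above) , lk′ =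
      <-≤-trans (<-trans (upper-increasing j<j′ j′<m upper upper′) above)
                (lower-increasing-≤ 1+k′≤k k<m lower′ lower)
      where
      j′<m : j′ < m
      j′<m = <-≤-trans j′<1+k′ (≤-trans 1+k′≤k (<⇒≤ k<m))
      j<j′ : j < j′
      j<j′ = level-reflects-< (subst (level j <_) (sym (trans same lk′)) ≤-refl)

    -- An entry of level ℓ has weight  Q ^ (2m ∸ 2ℓ)  if lower and
    -- Q ^ (2m ∸ 2ℓ ∸ 1)  if upper, with Q > m: weights drop by a factor Q from
    -- the lower entries of a level to its upper entries and again to the lower
    -- entries of the next level.  The offset of k is its weight plus the largest
    -- offset it must exceed: that of the previous entry of its level, and those
    -- of the upper entries it lies above one level down.
    Q : ℕ
    Q = suc m

    weight : ℕ → ℕ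
    weight x = Q ^ (m + m ∸ x)

    lowerWeight upperWeight : ℕ → ℕ
    lowerWeight ℓ = weight (ℓ + ℓ)
    upperWeight ℓ = weight (suc (ℓ + ℓ))

    rank : ℕ → ℕ
    rank k = if up k then suc (level k + level k) else level k + level k

    Feeds : ℕ → ℕ → Set
    Feeds j k = Upper j × Lower k × suc (level j) ≡ level k × v j < v k

    feeds? : ∀ j k → Dec (Feeds j k)
    feeds? j k = (up j Bool.≟ true) ×-dec (up k Bool.≟ false) ×-dec (suc (level j) ≟ level k) ×-dec (v j <? v k)

    previous : (ℕ → ℕ) → ℕ → ℕ
    previous f zero    = 0
    previous f (suc k) = if does (level k ≟ level (suc k)) then f k else 0

    previous-same : ∀ f {k} → level k ≡ level (suc k) → previous f (suc k) ≡ f k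
    previous-same f {k} same = cong (if_then f k else 0) (dec-true (level k ≟ level (suc k)) same)

    previous-new : ∀ f {k} → level k ≢ level (suc k) → previous f (suc k) ≡ 0
    previous-new f {k} new = cong (if_then f k else 0) (dec-false (level k ≟ level (suc k)) new)

    fedValue : (ℕ → ℕ) → ℕ → ℕ → ℕ
    fedValue f k j = if does (feeds? j k) then f j else 0

    fedValue-yes : ∀ f {j k} → Feeds j k → fedValue f k j ≡ f j
    fedValue-yes f {j} {k} feeds = cong (if_then f j else 0) (dec-true (feeds? j k) feeds)

    fedValue-no : ∀ f {j k} → ¬ Feeds j k → fedValue f k j ≡ 0
    fedValue-no f {j} {k} ¬feeds = cong (if_then f j else 0) (dec-false (feeds? j k) ¬feeds)

    fedMax : (ℕ → ℕ) → ℕ → ℕ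
    fedMax f k = maxBelow k (fedValue f k)

    offsetStep : (ℕ → ℕ) → ℕ → ℕ
    offsetStep f k = (previous f k ⊔ fedMax f k) + weight (rank k)

    offsetStep-local : CourseOfValues.Local offsetStep
    offsetStep-local f g k agree =
      cong (_+ weight (rank k)) (cong₂ _⊔_ (previous-local k agree)
        (maxBelow-cong k (λ j j<k → cong (if does (feeds? j k) then_else 0) (agree j j<k))))
      where
      previous-local : ∀ k → (∀ j → j < k → f j ≡ g j) → previous f k ≡ previous g k
      previous-local zero    agree = refl
      previous-local (suc k) agree = cong (if does (level k ≟ level (suc k)) then_else 0) (agree k ≤-refl)

    offset : ℕ → ℕ
    offset = CourseOfValues.fixpoint offsetStep

    offset-unfold : ∀ k → offset k ≡ (previous offset k ⊔ fedMax offset k) + weight (rank k)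
    offset-unfold = CourseOfValues.unfold offsetStep offsetStep-local

    offset-≥-previous : ∀ k → previous offset k + weight (rank k) ≤ offset k
    offset-≥-previous k = subst (previous offset k + weight (rank k) ≤_) (sym (offset-unfold k))
      (+-monoˡ-≤ (weight (rank k)) (m≤m⊔n (previous offset k) (fedMax offset k)))

    offset-≥-fed : ∀ k → fedMax offset k + weight (rank k) ≤ offset k
    offset-≥-fed k = subst (fedMax offset k + weight (rank k) ≤_) (sym (offset-unfold k))
      (+-monoˡ-≤ (weight (rank k)) (m≤n⊔m (previous offset k) (fedMax offset k)))

    offset-≥-weight : ∀ k → weight (rank k) ≤ offset k
    offset-≥-weight k = ≤-trans (m≤n+m _ _) (offset-≥-previous k)

    weight-positive : ∀ x → 0 < weight x
    weight-positive x = m^n>0 Q (m + m ∸ x)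

    weight-antitone : ∀ {x y} → x ≤ y → weight y ≤ weight x
    weight-antitone x≤y = ^-monoʳ-≤ Q (∸-monoʳ-≤ (m + m) x≤y)

    rank-upper : ∀ {k} → Upper k → rank k ≡ suc (level k + level k)
    rank-upper {k} upper rewrite upper = refl

    weight-≤-lowerWeight : ∀ k → weight (rank k) ≤ lowerWeight (level k)
    weight-≤-lowerWeight k with up k
    ... | true  = weight-antitone (n≤1+n (level k + level k))
    ... | false = ≤-refl

    upperWeight-next : ∀ ℓ → suc ℓ + suc ℓ ≤ m + m → upperWeight ℓ ≡ Q * lowerWeight (suc ℓ)
    upperWeight-next ℓ fits = cong (Q ^_) (trans (+-∸-assoc 1 fits′)
      (cong (λ x → suc (m + m ∸ suc x)) (sym (+-suc ℓ ℓ))))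
      where
      fits′ : suc (suc (ℓ + ℓ)) ≤ m + m
      fits′ = subst (λ x → suc x ≤ m + m) (+-suc ℓ ℓ) fits

    offset-grows : ∀ {j k} → j < k → level j ≡ level k → offset j + weight (rank k) ≤ offset k
    offset-grows {k = zero} ()
    offset-grows {j} {suc k} j<1+k same = growth (m<1+n⇒m<n∨m≡n j<1+k)
      where
      stays : level k ≡ level (suc k)
      stays = ≤-antisym (level-suc k) (subst (_≤ level k) same (level-mono (s≤s⁻¹ j<1+k)))
      step : offset k + weight (rank (suc k)) ≤ offset (suc k)
      step = subst (λ x → x + weight (rank (suc k)) ≤ offset (suc k)) (previous-same offset stays)
               (offset-≥-previous (suc k))
      growth : j < k ⊎ j ≡ k → offset j + weight (rank (suc k)) ≤ offset (suc k)
      growth (inj₂ refl) = step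
      growth (inj₁ j<k)  =
        ≤-trans (+-monoˡ-≤ _ (≤-trans (m≤m+n _ _) (offset-grows j<k (trans same (sym stays))))) step

    offset-upper-gap : ∀ {i j} → i < m → j < m → Upper i → Upper j → level i ≡ level j → v i < v j →
                       offset i + upperWeight (level j) ≤ offset j
    offset-upper-gap {i} {j} i<m j<m ui uj same vi<vj with <-cmp i j
    ... | tri< i<j _ _ = subst (λ x → offset i + weight x ≤ offset j) (rank-upper uj) (offset-grows i<j same)
    ... | tri≈ _ refl _ = ⊥-elim (<-irrefl refl vi<vj)
    ... | tri> _ _ j<i = ⊥-elim (<-asym vi<vj (upper-increasing j<i i<m uj ui))

    feed-ascends : ∀ {j k} → j < k → Upper j → Lower k → suc (level j) ≡ level k → v j < v k →
                   offset j < offset k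
    feed-ascends {j} {k} j<k upper lower next above =
      <-≤-trans (≤-<-trans fed (m<m+n _ (weight-positive (rank k)))) (offset-≥-fed k)
      where
      fed : offset j ≤ fedMax offset k
      fed = subst (_≤ fedMax offset k) (fedValue-yes offset (upper , lower , next , above))
              (maxBelow-upper (fedValue offset k) j<k)

    -- Let j be an upper entry of level ℓ and k an entry of level ℓ+1 such that
    -- the lower entries of level ℓ+1 up to k all lie below j.  Everything fed
    -- into the offset of k comes from upper entries of level ℓ left of j, so the
    -- offset of k stays below that of j up to k+1 weights of level ℓ+1.
    offset-below-upper : ∀ {j} k → k < m → j < m → Upper j → suc (level j) ≡ level k →
      (∀ i → i ≤ k → Lower i → level i ≡ level k → v i < v j) →
      offset k + upperWeight (level j) ≤ offset j + suc k * lowerWeight (level k)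
    offset-below-upper {j} k k<m j<m upper next below = begin
      offset k + uW                          ≡⟨ cong (_+ uW) (offset-unfold k) ⟩
      earlier ⊔ fedMax offset k + weight (rank k) + uW
                                             ≡⟨ swap₂ (earlier ⊔ fedMax offset k) (weight (rank k)) uW ⟩
      earlier ⊔ fedMax offset k + uW + weight (rank k)
                                             ≤⟨ +-mono-≤ contributions (weight-≤-lowerWeight k) ⟩
      offset j + k * lW + lW                 ≡⟨ regroup (offset j) k lW ⟩
      offset j + suc k * lW                  ∎
      where
      open ≤-Reasoning
      uW lW earlier : ℕ
      uW = upperWeight (level j)
      lW = lowerWeight (level k)
      earlier = previous offset k
      swap₂ : ∀ a b c → a + b + c ≡ a + c + b
      swap₂ = solve-∀
      regroup : ∀ a k w → a + k * w + w ≡ a + suc k * w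
      regroup = solve-∀
      uW≤offset : uW ≤ offset j
      uW≤offset = subst (λ x → weight x ≤ offset j) (rank-upper upper) (offset-≥-weight j)
      previous-part : ∀ k → k < m → suc (level j) ≡ level k →
        (∀ i → i ≤ k → Lower i → level i ≡ level k → v i < v j) →
        previous offset k + uW ≤ offset j + k * lowerWeight (level k)
      previous-part zero    _ _ _ = ≤-trans uW≤offset (m≤m+n _ _)
      previous-part (suc k) 1+k<m next below with level k ≟ level (suc k)
      ... | no  new  = subst (λ x → x + uW ≤ offset j + suc k * lowerWeight (level (suc k)))
                         (sym (previous-new offset new)) (≤-trans uW≤offset (m≤m+n _ _))
      ... | yes same = subst₂ (λ x ℓ → x + uW ≤ offset j + suc k * lowerWeight ℓ)
                         (sym (previous-same offset same)) same
        (offset-below-upper k (<-trans (n<1+n k) 1+k<m) j<m upper (trans next (sym same))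
          (λ i i≤k lower level-i → below i (m≤n⇒m≤1+n i≤k) lower (trans level-i same)))
      fed-part : fedMax offset k + uW ≤ offset j
      fed-part = maxBelow-least k _ fed-one uW≤offset
        where
        fed-one : ∀ i → i < k → fedValue offset k i + uW ≤ offset j
        fed-one i i<k with feeds? i k
        ... | no  ¬feeds = subst (λ x → x + uW ≤ offset j) (sym (fedValue-no offset ¬feeds)) uW≤offset
        ... | yes feeds@(upper-i , lower-k , next-i , above) =
          subst (λ x → x + uW ≤ offset j) (sym (fedValue-yes offset feeds)) $
          offset-upper-gap (<-trans i<k k<m) j<m upper-i upper
            (suc-injective (trans next-i (sym next))) (<-trans above (below k ≤-refl lower-k refl))
      contributions : earlier ⊔ fedMax offset k + uW ≤ offset j + k * lW
      contributions rewrite +-distribʳ-⊔ uW (previous offset k) (fedMax offset k) =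
        ⊔-lub (previous-part k k<m next below) (≤-trans fed-part (m≤m+n _ _))

    feed-descends : ∀ {j k} → j < k → k < m → Upper j → Lower k → suc (level j) ≡ level k → v k < v j →
                    offset k < offset j
    feed-descends {j} {k} j<k k<m upper lower next below =
      <-by-summands bounded (*-monoˡ-< (lowerWeight (level k)) {{lowerWeight≢0}} (s≤s k<m))
      where
      lowerWeight≢0 : NonZero (lowerWeight (level k))
      lowerWeight≢0 = ≢-nonZero (>⇒≢ (weight-positive (level k + level k)))
      fits : suc (level j) + suc (level j) ≤ m + m
      fits = subst (λ ℓ → ℓ + ℓ ≤ m + m) (sym next)
               (+-mono-≤ (<⇒≤ (≤-<-trans (level-≤ k) k<m)) (<⇒≤ (≤-<-trans (level-≤ k) k<m)))
      lower-below : ∀ i → i ≤ k → Lower i → level i ≡ level k → v i < v j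
      lower-below i i≤k lower-i _ = ≤-<-trans (lower-increasing-≤ i≤k k<m lower-i lower) below
      bounded : offset k + Q * lowerWeight (level k) ≤ offset j + suc k * lowerWeight (level k)
      bounded = subst (λ x → offset k + x ≤ offset j + suc k * lowerWeight (level k))
                  (trans (upperWeight-next (level j) fits) (cong (λ ℓ → Q * lowerWeight ℓ) next))
                  (offset-below-upper k k<m (<-trans j<k k<m) upper next lower-below)

    -- offsets do not depend on e and are bounded, so a large window dominates them
    offset-bound : ∀ k → offset k ≤ suc k * weight 0
    offset-bound = <-rec _ bound-step
      where
      open ≤-Reasoning
      bound-step : ∀ k → (∀ {i} → i < k → offset i ≤ suc i * weight 0) → offset k ≤ suc k * weight 0
      bound-step k earlier = begin
        offset k                                                ≡⟨ offset-unfold k ⟩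
        (previous offset k ⊔ fedMax offset k) + weight (rank k) ≤⟨ +-mono-≤ (⊔-lub (previous-part k earlier) fed-part)
                                                                             (weight-antitone {0} {rank k} z≤n) ⟩
        k * weight 0 + weight 0                                 ≡⟨ +-comm (k * weight 0) (weight 0) ⟩
        suc k * weight 0                                        ∎
        where
        previous-part : ∀ k → (∀ {i} → i < k → offset i ≤ suc i * weight 0) → previous offset k ≤ k * weight 0
        previous-part zero    _ = z≤n
        previous-part (suc k) earlier with level k ≟ level (suc k)
        ... | yes same = subst (_≤ suc k * weight 0) (sym (previous-same offset same)) (earlier (n<1+n k))
        ... | no  new  = subst (_≤ suc k * weight 0) (sym (previous-new offset new)) z≤n
        fed-one : ∀ i → i < k → fedValue offset k i + 0 ≤ k * weight 0
        fed-one i i<k with feeds? i k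
        ... | yes feeds = subst (_≤ k * weight 0) (sym (trans (+-identityʳ _) (fedValue-yes offset feeds)))
                            (≤-trans (earlier i<k) (*-monoˡ-≤ (weight 0) i<k))
        ... | no ¬feeds = subst (_≤ k * weight 0) (sym (cong (_+ 0) (fedValue-no offset ¬feeds))) z≤n
        fed-part : fedMax offset k ≤ k * weight 0
        fed-part = subst (_≤ k * weight 0) (+-identityʳ _) (maxBelow-least k _ fed-one z≤n)

    bound : ℕ
    bound = suc (m * weight 0)

    offset-small : ∀ {k} → k < m → offset k < bound
    offset-small k<m = s≤s (≤-trans (offset-bound _) (*-monoˡ-≤ (weight 0) k<m))

    level-gap : ∀ {x y} → x ≤ y → x ≡ y ⊎ suc x ≡ y ⊎ 2 + x ≤ y
    level-gap x≤y with m≤n⇒m<n∨m≡n x≤y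
    ... | inj₂ x≡y = inj₁ x≡y
    ... | inj₁ x<y with m≤n⇒m<n∨m≡n x<y
    ...   | inj₂ 1+x≡y = inj₂ (inj₁ 1+x≡y)
    ...   | inj₁ 1+x<y = inj₂ (inj₂ 1+x<y)

    record Schedule (e : ℕ) : Set where
      field
        time       : ℕ → ℕ
        increasing : ∀ {j k} → j < k → k < m → time j < time k
        window     : ∀ {j k} → j < k → k < m → Upper j → Lower k → (time k ≤ time j + e ⇔ v k < v j)

    schedule : ∀ e → bound ≤ e → Schedule e
    schedule e bound≤e = record { time = time ; increasing = increasing ; window = window }
      where
      time : ℕ → ℕ
      time k = e * level k + offset k

      next-level : ∀ ℓ → e * suc ℓ ≡ e * ℓ + e
      next-level ℓ = trans (*-suc e ℓ) (+-comm e (e * ℓ))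

      small : ∀ {k} → k < m → offset k < e
      small k<m = <-≤-trans (offset-small k<m) bound≤e

      below-next-level : ∀ {k} → k < m → time k < e * suc (level k)
      below-next-level {k} k<m =
        subst (time k <_) (sym (next-level (level k))) (+-monoʳ-< (e * level k) (small k<m))

      increasing : ∀ {j k} → j < k → k < m → time j < time k
      increasing {j} {k} j<k k<m with level j ≟ level k
      ... | yes same = +-mono-≤-< (≤-reflexive (cong (e *_) same))
                         (<-≤-trans (m<m+n (offset j) (weight-positive (rank k))) (offset-grows j<k same))
      ... | no  new  = <-≤-trans (below-next-level (<-trans j<k k<m))
                         (≤-trans (*-monoʳ-≤ e (≤∧≢⇒< (level-mono (<⇒≤ j<k)) new)) (m≤m+n _ _))

      window : ∀ {j k} → j < k → k < m → Upper j → Lower k → (time k ≤ time j + e ⇔ v k < v j)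
      -- within a level both sides hold, two or more levels apart both fail,
      -- and across adjacent levels the offsets decide
      window {j} {k} j<k k<m upper lower with level-gap (level-mono (<⇒≤ j<k))
      ... | inj₁ same = mk⇔ (λ _ → sameLevel-descent j<k k<m upper lower same) (λ _ → close)
        where
        close : time k ≤ time j + e
        close = subst (λ ℓ → e * ℓ + offset k ≤ time j + e) same
                  (subst (e * level j + offset k ≤_) (sym (+-assoc (e * level j) (offset j) e))
                    (+-monoʳ-≤ (e * level j) (≤-trans (<⇒≤ (small k<m)) (m≤n+m e (offset j)))))
      ... | inj₂ (inj₁ next) = mk⇔ to from
        where
        base : ℕ
        base = e * level j + e
        time-k : time k ≡ base + offset k
        time-k = trans (cong (λ ℓ → e * ℓ + offset k) (sym next)) (cong (_+ offset k) (next-level (level j)))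
        time-j : time j + e ≡ base + offset j
        time-j = shuffle (e * level j) (offset j) e
          where
          shuffle : ∀ a b c → a + b + c ≡ a + c + b
          shuffle = solve-∀
        to : time k ≤ time j + e → v k < v j
        to close = distinct k<m j<m (λ k≡j → <-irrefl (sym k≡j) j<k)
          (≮⇒≥ (λ above → <⇒≱ (feed-ascends j<k upper lower next above)
                                 (+-cancelˡ-≤ base (offset k) (offset j) (subst₂ _≤_ time-k time-j close))))
          where
          j<m : j < m
          j<m = <-trans j<k k<m
        from : v k < v j → time k ≤ time j + e
        from below = subst₂ _≤_ (sym time-k) (sym time-j)
          (+-monoʳ-≤ base (<⇒≤ (feed-descends j<k k<m upper lower next below)))
      ... | inj₂ (inj₂ far) = mk⇔ (λ close → ⊥-elim (<⇒≱ too-late close))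
                                  (λ below → ⊥-elim (<-asym below (farLevel-ascent j<k k<m upper lower far)))
        where
        too-late : time j + e < time k
        too-late = <-≤-trans (+-monoˡ-< e (below-next-level (<-trans j<k k<m)))
                     (≤-trans (≤-reflexive (sym (next-level (suc (level j)))))
                       (≤-trans (*-monoʳ-≤ e far) (m≤m+n _ _)))

module Embedding where

  open TwoChainSchedules using (module TwoChains)
  open import Data.Nat as ℕ using (ℕ; zero; suc; NonZero; _<?_)
  import Data.Nat.Properties as ℕ
  open import Data.Nat.DivMod using (_/_; m≡m%n+[m/n]*n; m%n<n; m/n*n≤m; m*n/n≡m; /-monoˡ-≤)
  open import Data.Integer using (ℤ; +_; -[1+_]; _+_; _-_; _*_; -_; _<_; +<+)
  import Data.Integer.Properties as ℤ
  open import Data.Integer.Tactic.RingSolver using (solve-∀)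
  open import Data.Fin as Fin using (Fin; toℕ; fromℕ<)
  import Data.Fin.Properties as Fin
  open import Data.Fin.Permutation using (Permutation′; _⟨$⟩ʳ_; _⟨$⟩ˡ_; inverseˡ)
  open import Data.Bool using (Bool; true; false; not; if_then_else_)
  open import Data.Product using (∃; _×_; _,_; proj₁)
  open import Data.Empty using (⊥-elim)
  open import Function.Bundles using (_⇔_; mk⇔; Equivalence)
  open import Relation.Nullary using (Dec; yes; no; does; ¬_)
  open import Relation.Binary.PropositionalEquality
  open import Relation.Binary.Definitions using (tri<; tri≈; tri>)

  order-equivalence : ∀ {m} (f g : ℕ → ℕ) →
    (∀ {j k} → j ℕ.< m → k ℕ.< m → f j ≡ f k → j ≡ k) →
    (∀ {j k} → j ℕ.< m → k ℕ.< m → g j ≡ g k → j ≡ k) →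
    (∀ {j k} → j ℕ.< k → k ℕ.< m → (f j ℕ.< f k ⇔ g j ℕ.< g k)) →
    ∀ {j k} → j ℕ.< m → k ℕ.< m → (f j ℕ.< f k ⇔ g j ℕ.< g k)
  order-equivalence {m} f g f-inj g-inj ascending {j} {k} j<m k<m with ℕ.<-cmp j k
  ... | tri< j<k _ _ = ascending j<k k<m
  ... | tri≈ _ refl _ = mk⇔ (λ f< → ⊥-elim (ℕ.<-irrefl refl f<)) (λ g< → ⊥-elim (ℕ.<-irrefl refl g<))
  ... | tri> _ _ k<j = mk⇔ (reverse f g g-inj (Equivalence.from swapped)) (reverse g f f-inj (Equivalence.to swapped))
    where
    swapped : f k ℕ.< f j ⇔ g k ℕ.< g j
    swapped = ascending k<j j<m
    reverse : ∀ (h h′ : ℕ → ℕ) → (∀ {j k} → j ℕ.< m → k ℕ.< m → h′ j ≡ h′ k → j ≡ k) →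
              (h′ k ℕ.< h′ j → h k ℕ.< h j) → h j ℕ.< h k → h′ j ℕ.< h′ k
    reverse h h′ h′-inj back h< = ℕ.≤∧≢⇒< (ℕ.≮⇒≥ (λ h′> → ℕ.<-asym h< (back h′>)))
                                           (λ e → ℕ.<-irrefl (sym (h′-inj j<m k<m e)) k<j)

  module LeftToRightMaxima {m} (p : Permutation′ m) (avoids : Avoids321 p) where

    -- the entries of p as naturals (0 outside [0, m))
    value : ℕ → ℕ
    value k with k <? m
    ... | yes k<m = toℕ (p ⟨$⟩ʳ fromℕ< k<m)
    ... | no  _   = 0

    value-at : ∀ {k} (k<m : k ℕ.< m) → value k ≡ toℕ (p ⟨$⟩ʳ fromℕ< k<m)
    value-at {k} k<m with k <? m
    ... | yes _   = refl
    ... | no  k≮m = ⊥-elim (k≮m k<m)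

    value-fin : ∀ a → value (toℕ a) ≡ toℕ (p ⟨$⟩ʳ a)
    value-fin a = trans (value-at (Fin.toℕ<n a)) (cong (λ b → toℕ (p ⟨$⟩ʳ b)) (Fin.fromℕ<-toℕ a (Fin.toℕ<n a)))

    value-injective : ∀ {j k} → j ℕ.< m → k ℕ.< m → value j ≡ value k → j ≡ k
    value-injective {j} {k} j<m k<m e = Fin.fromℕ<-injective j k j<m k<m
      (trans (sym (inverseˡ p)) (trans (cong (p ⟨$⟩ˡ_) same-image) (inverseˡ p)))
      where
      same-image : p ⟨$⟩ʳ fromℕ< j<m ≡ p ⟨$⟩ʳ fromℕ< k<m
      same-image = Fin.toℕ-injective (trans (sym (value-at j<m)) (trans e (value-at k<m)))

    distinct : ∀ {j k} → j ℕ.< m → k ℕ.< m → j ≢ k → value j ℕ.≤ value k → value j ℕ.< value k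
    distinct j<m k<m j≢k le = ℕ.≤∧≢⇒< le (λ e → j≢k (value-injective j<m k<m e))

    LargerBefore : ℕ → Set
    LargerBefore k = ∃ λ j → j ℕ.< k × value k ℕ.< value j

    largerBefore? : ∀ k → Dec (LargerBefore k)
    largerBefore? k = ℕ.anyUpTo? (λ j → value k <? value j) k

    up : ℕ → Bool
    up k = not (does (largerBefore? k))

    up-true : ∀ {k} → up k ≡ true → ¬ LargerBefore k
    up-true {k} = from-decision (largerBefore? k)
      where
      from-decision : (d : Dec (LargerBefore k)) → not (does d) ≡ true → ¬ LargerBefore k
      from-decision (no ¬larger) _ = ¬larger

    up-false : ∀ {k} → up k ≡ false → LargerBefore k
    up-false {k} = from-decision (largerBefore? k)
      where
      from-decision : (d : Dec (LargerBefore k)) → not (does d) ≡ false → LargerBefore k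
      from-decision (yes larger) _ = larger

    upper-above : ∀ {j k} → j ℕ.< k → k ℕ.< m → up k ≡ true → value j ℕ.< value k
    upper-above j<k k<m upper = distinct (ℕ.<-trans j<k k<m) k<m (λ e → ℕ.<-irrefl e j<k)
      (ℕ.≮⇒≥ (λ above → up-true upper (_ , j<k , above)))

    upper-increasing : ∀ {j k} → j ℕ.< k → k ℕ.< m → up j ≡ true → up k ≡ true → value j ℕ.< value k
    upper-increasing j<k k<m _ upper = upper-above j<k k<m upper

    -- a descent between two lower entries would complete a 321 pattern
    lower-increasing : ∀ {j k} → j ℕ.< k → k ℕ.< m → up j ≡ false → up k ≡ false → value j ℕ.< value k
    lower-increasing {j} {k} j<k k<m lower _ with up-false lower
    ... | i , i<j , j-below-i with value j ℕ.<? value k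
    ...   | yes ascent = ascent
    ...   | no ¬ascent = ⊥-elim (avoids (fromℕ< i<m) (fromℕ< j<m) (fromℕ< k<m)
                                         (positions i<m j<m i<j) (positions j<m k<m j<k)
                                         (values j<m i<m j-below-i , values k<m j<m k-below-j))
      where
      j<m : j ℕ.< m
      j<m = ℕ.<-trans j<k k<m
      i<m : i ℕ.< m
      i<m = ℕ.<-trans i<j j<m
      k-below-j : value k ℕ.< value j
      k-below-j = distinct k<m j<m (λ e → ℕ.<-irrefl (sym e) j<k) (ℕ.≮⇒≥ ¬ascent)
      positions : ∀ {a b} (a<m : a ℕ.< m) (b<m : b ℕ.< m) → a ℕ.< b → fromℕ< a<m Fin.< fromℕ< b<m
      positions a<m b<m a<b = subst₂ ℕ._<_ (sym (Fin.toℕ-fromℕ< a<m)) (sym (Fin.toℕ-fromℕ< b<m)) a<b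
      values : ∀ {a b} (a<m : a ℕ.< m) (b<m : b ℕ.< m) → value a ℕ.< value b →
               (p ⟨$⟩ʳ fromℕ< a<m) Fin.< (p ⟨$⟩ʳ fromℕ< b<m)
      values a<m b<m a<b = subst₂ ℕ._<_ (value-at a<m) (value-at b<m) a<b

    open TwoChains m value up value-injective upper-increasing lower-increasing public
      using (Schedule; schedule; bound)

  module Periodicity (n : ℕ) (ω : ℤ → ℤ) (affine : IsAffinePerm n ω) where

    shift : ∀ x s → ω (x + + (s ℕ.* n)) ≡ ω x + + (s ℕ.* n)
    shift x zero    = trans (cong ω (ℤ.+-identityʳ x)) (sym (ℤ.+-identityʳ (ω x)))
    shift x (suc s) = begin
      ω (x + + (n ℕ.+ s ℕ.* n))   ≡⟨ cong ω (regroup x (s ℕ.* n)) ⟩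
      ω (x + + (s ℕ.* n) + + n)   ≡⟨ IsAffinePerm.periodic affine _ ⟩
      ω (x + + (s ℕ.* n)) + + n   ≡⟨ cong (_+ + n) (shift x s) ⟩
      ω x + + (s ℕ.* n) + + n     ≡⟨ sym (regroup (ω x) (s ℕ.* n)) ⟩
      ω x + + (n ℕ.+ s ℕ.* n)     ∎
      where
      open ≡-Reasoning
      regroup : ∀ y t → y + + (n ℕ.+ t) ≡ y + + t + + n
      regroup y t = trans (cong (λ u → y + u) (ℤ.pos-+ n t)) (swap y (+ n) (+ t))
        where
        swap : ∀ a b c → a + (b + c) ≡ a + c + b
        swap = solve-∀

    shift-ℤ : ∀ x q → ω (x + q * + n) ≡ ω x + q * + n
    shift-ℤ x (+ s) = trans (cong (λ t → ω (x + t)) (sym (ℤ.pos-* s n)))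
                        (trans (shift x s) (cong (λ t → ω x + t) (ℤ.pos-* s n)))
    shift-ℤ x -[1+ s ] = begin
      ω y                       ≡⟨ sym (cancel (ω y) c (+ n)) ⟩
      ω y + c * + n - c * + n   ≡⟨ cong (_- c * + n) (sym (shift-ℤ y c)) ⟩
      ω (y + c * + n) - c * + n ≡⟨ cong (λ z → ω z - c * + n) (back x c (+ n)) ⟩
      ω x - c * + n             ≡⟨ negate (ω x) c (+ n) ⟩
      ω x + (- c) * + n         ∎
      where
      open ≡-Reasoning
      c : ℤ
      c = + suc s
      y : ℤ
      y = x + (- c) * + n
      cancel : ∀ a c k → a + c * k - c * k ≡ a
      cancel = solve-∀
      back : ∀ x c k → x + (- c) * k + c * k ≡ x
      back = solve-∀
      negate : ∀ a c k → a - c * k ≡ a + (- c) * k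
      negate = solve-∀

  cancel-left : ∀ a x → - a + (a + x) ≡ x
  cancel-left = solve-∀

  +-cancelˡ : ∀ a {x y} → a + x ≡ a + y → x ≡ y
  +-cancelˡ a {x} {y} e = trans (sym (cancel-left a x)) (trans (cong (λ z → - a + z) e) (cancel-left a y))

  +-reflectˡ-< : ∀ a {x y} → a + x < a + y → x < y
  +-reflectˡ-< a {x} {y} lt = subst₂ _<_ (cancel-left a x) (cancel-left a y) (ℤ.+-monoʳ-< (- a) lt)

  bracket : ∀ n {{_ : NonZero n}} W E → W ℕ.* n ℕ.< E →
            ∃ λ e → W ℕ.≤ e × e ℕ.* n ℕ.< E × E ℕ.≤ suc e ℕ.* n
  bracket n W (suc E) W*n<1+E = E / n , W≤e , ℕ.s≤s (m/n*n≤m E n) , 1+E≤[1+e]*n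
    where
    W≤e : W ℕ.≤ E / n
    W≤e = subst (ℕ._≤ E / n) (m*n/n≡m W n) (/-monoˡ-≤ n (ℕ.s≤s⁻¹ W*n<1+E))
    1+E≤[1+e]*n : suc E ℕ.≤ suc (E / n) ℕ.* n
    1+E≤[1+e]*n = subst (λ x → x ℕ.< suc (E / n) ℕ.* n) (sym (m≡m%n+[m/n]*n E n))
                    (ℕ.+-monoˡ-< (E / n ℕ.* n) (m%n<n E n))

  -- Two strands of an affine permutation realise p: if values at positions
  -- i and i+r (0 ≤ r < n) are in the wrong order by a large amount E, the
  -- upper chain of p is placed on the strand i + t*n and the lower chain on the
  -- strand i + r + t*n, at the blocks t given by a schedule with window e,
  -- where e*n < E ≤ (e+1)*n.
  module TwoStrands (n : ℕ) {{_ : NonZero n}} (ω : ℤ → ℤ) (affine : IsAffinePerm n ω)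
                    {m} (p : Permutation′ m) (avoids : Avoids321 p) where

    open LeftToRightMaxima p avoids
    open Periodicity n ω affine using (shift)

    ω-injective : ∀ {x y} → ω x ≡ ω y → x ≡ y
    ω-injective = proj₁ (IsAffinePerm.bijective affine)

    module Realisation {e} (S : Schedule e) (i : ℤ) {r} (r<n : r ℕ.< n) (E : ℕ)
                       (e*n<E : e ℕ.* n ℕ.< E) (E≤[1+e]*n : E ℕ.≤ suc e ℕ.* n)
                       (gap : ω i ≡ ω (i + + r) + + E) where

      open Schedule S

      position height : ℕ → ℕ
      position k = (if up k then 0 else r) ℕ.+ time k ℕ.* n
      height   k = (if up k then E else 0) ℕ.+ time k ℕ.* n

      ω-position : ∀ k → ω (i + + position k) ≡ ω (i + + r) + + height k
      ω-position k = strand (up k) (time k)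
        where
        open ≡-Reasoning
        strand : ∀ c t → ω (i + + ((if c then 0 else r) ℕ.+ t ℕ.* n)) ≡
                         ω (i + + r) + + ((if c then E else 0) ℕ.+ t ℕ.* n)
        strand true  t = begin
          ω (i + + (t ℕ.* n))               ≡⟨ shift i t ⟩
          ω i + + (t ℕ.* n)                 ≡⟨ cong (_+ + (t ℕ.* n)) gap ⟩
          ω (i + + r) + + E + + (t ℕ.* n)   ≡⟨ ℤ.+-assoc (ω (i + + r)) (+ E) (+ (t ℕ.* n)) ⟩
          ω (i + + r) + (+ E + + (t ℕ.* n)) ≡⟨ cong (λ z → ω (i + + r) + z) (sym (ℤ.pos-+ E (t ℕ.* n))) ⟩
          ω (i + + r) + + (E ℕ.+ t ℕ.* n)   ∎
        strand false t = begin
          ω (i + + (r ℕ.+ t ℕ.* n))         ≡⟨ cong (λ z → ω (i + z)) (ℤ.pos-+ r (t ℕ.* n)) ⟩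
          ω (i + (+ r + + (t ℕ.* n)))       ≡⟨ cong ω (sym (ℤ.+-assoc i (+ r) (+ (t ℕ.* n)))) ⟩
          ω (i + + r + + (t ℕ.* n))         ≡⟨ shift (i + + r) t ⟩
          ω (i + + r) + + (t ℕ.* n)         ∎

      position-increasing : ∀ {j k} → j ℕ.< k → k ℕ.< m → position j ℕ.< position k
      position-increasing {j} {k} j<k k<m = begin-strict
        position j                      ≤⟨ ℕ.+-monoˡ-≤ (time j ℕ.* n) (start≤r (up j)) ⟩
        r ℕ.+ time j ℕ.* n              <⟨ ℕ.+-monoˡ-< (time j ℕ.* n) r<n ⟩
        suc (time j) ℕ.* n              ≤⟨ ℕ.*-monoˡ-≤ n (increasing j<k k<m) ⟩
        time k ℕ.* n                    ≤⟨ ℕ.m≤n+m (time k ℕ.* n) _ ⟩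
        position k                      ∎
        where
        open ℕ.≤-Reasoning
        start≤r : ∀ c → (if c then 0 else r) ℕ.≤ r
        start≤r true  = ℕ.z≤n
        start≤r false = ℕ.≤-refl

      same-position : ∀ {a b} → height a ≡ height b → position a ≡ position b
      same-position {a} {b} e = ℤ.+-injective (+-cancelˡ i (ω-injective
        (trans (ω-position a) (trans (cong (λ h → ω (i + + r) + + h) e) (sym (ω-position b))))))

      height-injective : ∀ {j k} → j ℕ.< m → k ℕ.< m → height j ≡ height k → j ≡ k
      height-injective {j} {k} j<m k<m same with ℕ.<-cmp j k
      ... | tri≈ _ j≡k _ = j≡k
      ... | tri< j<k _ _ = ⊥-elim (ℕ.<-irrefl (same-position same) (position-increasing j<k k<m))
      ... | tri> _ _ k<j = ⊥-elim (ℕ.<-irrefl (same-position (sym same)) (position-increasing k<j j<m))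

      height-upper : ∀ {k} → up k ≡ true → height k ≡ E ℕ.+ time k ℕ.* n
      height-upper {k} upper = cong (λ c → (if c then E else 0) ℕ.+ time k ℕ.* n) upper

      height-lower : ∀ {k} → up k ≡ false → height k ≡ time k ℕ.* n
      height-lower {k} lower = cong (λ c → (if c then E else 0) ℕ.+ time k ℕ.* n) lower

      -- an upper entry j and a later lower entry k: their heights compare as the
      -- window of the schedule says, because e*n < E ≤ (e+1)*n
      upper-then-lower : ∀ {j k} → j ℕ.< k → k ℕ.< m → up j ≡ true → up k ≡ false →
                         (height j ℕ.< height k ⇔ value j ℕ.< value k)
      upper-then-lower {j} {k} j<k k<m upper lower with time k ℕ.≤? time j ℕ.+ e
      ... | yes close = mk⇔ (λ h → ⊥-elim (ℕ.<-asym h k-lower))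
                            (λ v → ⊥-elim (ℕ.<-asym v (Equivalence.to (window j<k k<m upper lower) close)))
        where
        open ℕ.≤-Reasoning
        k-lower : height k ℕ.< height j
        k-lower = begin-strict
          height k                        ≡⟨ height-lower lower ⟩
          time k ℕ.* n                    ≤⟨ ℕ.*-monoˡ-≤ n close ⟩
          (time j ℕ.+ e) ℕ.* n            ≡⟨ ℕ.*-distribʳ-+ n (time j) e ⟩
          time j ℕ.* n ℕ.+ e ℕ.* n        <⟨ ℕ.+-monoʳ-< (time j ℕ.* n) e*n<E ⟩
          time j ℕ.* n ℕ.+ E              ≡⟨ ℕ.+-comm (time j ℕ.* n) E ⟩
          E ℕ.+ time j ℕ.* n              ≡⟨ height-upper upper ⟨
          height j                        ∎
      ... | no late = mk⇔ (λ _ → ascent)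
                          (λ _ → ℕ.≤∧≢⇒< j-lower (λ e → ℕ.<-irrefl (height-injective j<m k<m e) j<k))
        where
        open ℕ.≤-Reasoning
        j<m : j ℕ.< m
        j<m = ℕ.<-trans j<k k<m
        ascent : value j ℕ.< value k
        ascent = distinct j<m k<m (λ e → ℕ.<-irrefl e j<k)
                   (ℕ.≮⇒≥ (λ below → late (Equivalence.from (window j<k k<m upper lower) below)))
        after-window : suc e ℕ.+ time j ℕ.≤ time k
        after-window = subst (ℕ._≤ time k) (cong suc (ℕ.+-comm (time j) e)) (ℕ.≰⇒> late)
        j-lower : height j ℕ.≤ height k
        j-lower = begin
          height j                        ≡⟨ height-upper upper ⟩
          E ℕ.+ time j ℕ.* n              ≤⟨ ℕ.+-monoˡ-≤ (time j ℕ.* n) E≤[1+e]*n ⟩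
          suc e ℕ.* n ℕ.+ time j ℕ.* n    ≡⟨ ℕ.*-distribʳ-+ n (suc e) (time j) ⟨
          (suc e ℕ.+ time j) ℕ.* n        ≤⟨ ℕ.*-monoˡ-≤ n after-window ⟩
          time k ℕ.* n                    ≡⟨ height-lower lower ⟨
          height k                        ∎

      height-order : ∀ {j k} → j ℕ.< k → k ℕ.< m → (height j ℕ.< height k ⇔ value j ℕ.< value k)
      height-order {j} {k} j<k k<m = by-chains (up j) (up k) refl refl
        where
        by-chains : ∀ c d → up j ≡ c → up k ≡ d → (height j ℕ.< height k ⇔ value j ℕ.< value k)
        by-chains true  false uj uk = upper-then-lower j<k k<m uj uk
        by-chains true  true  uj uk = mk⇔ (λ _ → upper-increasing j<k k<m uj uk)
          (λ _ → subst₂ ℕ._<_ (sym (height-upper uj)) (sym (height-upper uk))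
                   (ℕ.+-monoʳ-< E (ℕ.*-monoˡ-< n (increasing j<k k<m))))
        by-chains false false uj uk = mk⇔ (λ _ → lower-increasing j<k k<m uj uk)
          (λ _ → subst₂ ℕ._<_ (sym (height-lower uj)) (sym (height-lower uk))
                   (ℕ.*-monoˡ-< n (increasing j<k k<m)))
        by-chains false true  uj uk = mk⇔ (λ _ → upper-above j<k k<m uk)
          (λ _ → subst₂ ℕ._<_ (sym (height-lower uj)) (sym (height-upper uk))
                   (ℕ.<-≤-trans (ℕ.*-monoˡ-< n (increasing j<k k<m)) (ℕ.m≤n+m _ E)))

      contains : Contains ω p
      contains = index , index-increasing , order
        where
        index : Fin m → ℤ
        index a = i + + position (toℕ a)
        index-increasing : ∀ a b → a Fin.< b → index a < index b
        index-increasing a b a<b = ℤ.+-monoʳ-< i (+<+ (position-increasing a<b (Fin.toℕ<n b)))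
        order : ∀ a b → (ω (index a) < ω (index b)) ⇔ ((p ⟨$⟩ʳ a) Fin.< (p ⟨$⟩ʳ b))
        order a b = mk⇔
          (λ ω< → subst₂ ℕ._<_ (value-fin a) (value-fin b) (Equivalence.to heights
                    (ℤ.drop‿+<+ (+-reflectˡ-< (ω (i + + r)) (subst₂ _<_ (ω-position _) (ω-position _) ω<)))))
          (λ p< → subst₂ _<_ (sym (ω-position _)) (sym (ω-position _)) (ℤ.+-monoʳ-< (ω (i + + r))
                    (+<+ (Equivalence.from heights (subst₂ ℕ._<_ (sym (value-fin a)) (sym (value-fin b)) p<)))))
          where
          heights : height (toℕ a) ℕ.< height (toℕ b) ⇔ value (toℕ a) ℕ.< value (toℕ b)
          heights = order-equivalence height value height-injective value-injective height-order
                      (Fin.toℕ<n a) (Fin.toℕ<n b)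

    far-apart⇒contains : ∀ i {r} → r ℕ.< n → ∀ E → bound ℕ.* n ℕ.< E → ω i ≡ ω (i + + r) + + E →
                         Contains ω p
    far-apart⇒contains i r<n E big gap with bracket n bound E big
    ... | e , bound≤e , e*n<E , E≤[1+e]*n =
      Realisation.contains (schedule e bound≤e) i r<n E e*n<E E≤[1+e]*n gap

module Finiteness where

  open Embedding using (module Periodicity; module TwoStrands; module LeftToRightMaxima; +-reflectˡ-<)
  open import Data.Nat as ℕ using (ℕ; zero; suc; NonZero)
  import Data.Nat.Properties as ℕ
  open import Data.Nat.Combinatorics using (_C_; nCk+nC[k+1]≡[n+1]C[k+1]; nC1≡n)
  open import Data.Integer
    using (ℤ; +_; -[1+_]; _+_; _-_; _*_; -_; _<_; _≤_; _≤?_; +<+; +≤+; -≤-; _%ℕ_; _/ℕ_; ∣_∣)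
  import Data.Integer.Properties as ℤ
  open import Data.Integer.DivMod using (n%ℕd<d; a≡a%ℕn+[a/ℕn]*n)
  open import Data.Integer.Tactic.RingSolver using (solve-∀)
  open import Data.Fin as Fin using (toℕ; fromℕ<)
  import Data.Fin.Properties as Fin
  open import Data.Fin.Permutation using (Permutation′)
  open import Data.Vec using (Vec; []; _∷_; lookup; tabulate)
  open import Data.Vec.Properties using (lookup∘tabulate)
  open import Data.List using (List; [_]; map; _++_; upTo; cartesianProductWith)
  open import Data.List.Membership.Propositional using (_∈_)
  open import Data.List.Membership.Propositional.Properties
    using (∈-map⁺; ∈-++⁺ˡ; ∈-++⁺ʳ; ∈-upTo⁺; ∈-cartesianProductWith⁺)
  open import Data.List.Relation.Unary.Any using (Any; here)
  import Data.List.Relation.Unary.Any as Any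
  open import Data.Product using (∃; _×_; _,_; proj₁; proj₂)
  open import Data.Empty using (⊥-elim)
  open import Relation.Nullary using (yes; no; ¬_)
  open import Relation.Binary.PropositionalEquality hiding ([_])
  open import Relation.Binary.Definitions using (tri<; tri≈; tri>)

  windowSum-minus : ∀ f g k → windowSum (λ x → f x - g x) k ≡ windowSum f k - windowSum g k
  windowSum-minus f g zero    = refl
  windowSum-minus f g (suc k) = trans (cong (_+ (f (+ suc k) - g (+ suc k))) (windowSum-minus f g k))
                                       (regroup (windowSum f k) (windowSum g k) (f (+ suc k)) (g (+ suc k)))
    where
    regroup : ∀ a b c d → (a - b) + (c - d) ≡ (a + c) - (b + d)
    regroup = solve-∀

  windowSum-identity : ∀ k → windowSum (λ x → x) k ≡ + (suc k C 2)
  windowSum-identity zero    = refl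
  windowSum-identity (suc k) = begin
    windowSum (λ x → x) k + + suc k   ≡⟨ cong (_+ + suc k) (windowSum-identity k) ⟩
    + (suc k C 2) + + suc k           ≡⟨ ℤ.pos-+ (suc k C 2) (suc k) ⟨
    + (suc k C 2 ℕ.+ suc k)           ≡⟨ cong +_ (ℕ.+-comm (suc k C 2) (suc k)) ⟩
    + (suc k ℕ.+ suc k C 2)           ≡⟨ cong (λ x → + (x ℕ.+ suc k C 2)) (nC1≡n (suc k)) ⟨
    + (suc k C 1 ℕ.+ suc k C 2)       ≡⟨ cong +_ (nCk+nC[k+1]≡[n+1]C[k+1] (suc k) 1) ⟩
    + (suc (suc k) C 2)               ∎
    where open ≡-Reasoning

  windowSum-zero : ∀ k → windowSum (λ _ → + 0) k ≡ + 0
  windowSum-zero zero    = refl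
  windowSum-zero (suc k) = trans (ℤ.+-identityʳ _) (windowSum-zero k)

  windowSum-mono-≤ : ∀ f g k → (∀ j → j ℕ.< k → f (+ suc j) ≤ g (+ suc j)) → windowSum f k ≤ windowSum g k
  windowSum-mono-≤ f g zero    h = ℤ.≤-refl
  windowSum-mono-≤ f g (suc k) h =
    ℤ.+-mono-≤ (windowSum-mono-≤ f g k (λ j j<k → h j (ℕ.m<n⇒m<1+n j<k))) (h k ℕ.≤-refl)

  windowSum-mono-< : ∀ f g k → 0 ℕ.< k → (∀ j → j ℕ.< k → f (+ suc j) < g (+ suc j)) →
                     windowSum f k < windowSum g k
  windowSum-mono-< f g (suc k) _ h =
    ℤ.+-mono-≤-< (windowSum-mono-≤ f g k (λ j j<k → ℤ.<⇒≤ (h j (ℕ.m<n⇒m<1+n j<k)))) (h k ℕ.≤-refl)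

  vectors : ∀ {A : Set} n → List A → List (Vec A n)
  vectors zero    xs = [ [] ]
  vectors (suc n) xs = cartesianProductWith _∷_ xs (vectors n xs)

  vectors-complete : ∀ {A : Set} n (xs : List A) (v : Vec A n) → (∀ f → lookup v f ∈ xs) → v ∈ vectors n xs
  vectors-complete zero    xs []      _     = here refl
  vectors-complete (suc n) xs (x ∷ v) entry =
    ∈-cartesianProductWith⁺ _∷_ (entry Fin.zero) (vectors-complete n xs v (λ f → entry (Fin.suc f)))

  interval : ℕ → List ℤ
  interval B = map +_ (upTo (suc B)) ++ map -[1+_] (upTo B)

  interval-complete : ∀ B z → - (+ B) ≤ z → z ≤ + B → z ∈ interval B
  interval-complete B       (+ k)     _          (+≤+ k≤B) = ∈-++⁺ˡ (∈-map⁺ +_ (∈-upTo⁺ (ℕ.s≤s k≤B)))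
  interval-complete (suc B) -[1+ k ] (-≤- k≤B) _          =
    ∈-++⁺ʳ (map +_ (upTo (suc (suc B)))) (∈-map⁺ -[1+_] (∈-upTo⁺ (ℕ.s≤s k≤B)))
  interval-complete zero    -[1+ k ] ()        _

  module Displacement (n : ℕ) {{_ : NonZero n}} (ω : ℤ → ℤ) (affine : IsAffinePerm n ω) where

    open Periodicity n ω affine using (shift-ℤ)

    displacement : ℤ → ℤ
    displacement x = ω x - x

    displacement-periodic : ∀ x q → displacement (x + q * + n) ≡ displacement x
    displacement-periodic x q =
      trans (cong (_- (x + q * + n)) (shift-ℤ x q)) (cancel (ω x) x (q * + n))
      where
      cancel : ∀ a x c → (a + c) - (x + c) ≡ a - x
      cancel = solve-∀

    displacement-residue : ∀ x → ω x ≡ x + displacement (+ (x %ℕ n))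
    displacement-residue x = begin
      ω x                                            ≡⟨ restore (ω x) x ⟨
      x + displacement x                             ≡⟨ cong (λ y → x + displacement y) (a≡a%ℕn+[a/ℕn]*n x n) ⟩
      x + displacement (+ (x %ℕ n) + (x /ℕ n) * + n)
        ≡⟨ cong (λ d → x + d) (displacement-periodic (+ (x %ℕ n)) (x /ℕ n)) ⟩
      x + displacement (+ (x %ℕ n))                  ∎
      where
      open ≡-Reasoning
      restore : ∀ a x → x + (a - x) ≡ a
      restore = solve-∀

    displacement-sum : windowSum displacement n ≡ + 0
    displacement-sum = begin
      windowSum displacement n               ≡⟨ windowSum-minus ω (λ x → x) n ⟩
      windowSum ω n - windowSum (λ x → x) n  ≡⟨ cong₂ _-_ (IsAffinePerm.windowSum≡ affine) (windowSum-identity n) ⟩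
      + (suc n C 2) - + (suc n C 2)          ≡⟨ ℤ.+-inverseʳ (+ (suc n C 2)) ⟩
      + 0                                    ∎
      where open ≡-Reasoning

    nonpositive-somewhere : ∃ λ j → j ℕ.< n × displacement (+ suc j) ≤ + 0
    nonpositive-somewhere with ℕ.anyUpTo? (λ j → displacement (+ suc j) ≤? + 0) n
    ... | yes found = found
    ... | no  none  = ⊥-elim (ℤ.<-irrefl (trans (windowSum-zero n) (sym displacement-sum))
            (windowSum-mono-< (λ _ → + 0) displacement n (ℕ.>-nonZero⁻¹ n)
              (λ j j<n → ℤ.≰⇒> (λ ≤0 → none (j , j<n , ≤0)))))

    nonnegative-somewhere : ∃ λ j → j ℕ.< n × + 0 ≤ displacement (+ suc j)
    nonnegative-somewhere with ℕ.anyUpTo? (λ j → + 0 ≤? displacement (+ suc j)) n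
    ... | yes found = found
    ... | no  none  = ⊥-elim (ℤ.<-irrefl (trans displacement-sum (sym (windowSum-zero n)))
            (windowSum-mono-< displacement (λ _ → + 0) n (ℕ.>-nonZero⁻¹ n)
              (λ j j<n → ℤ.≰⇒> (λ 0≤ → none (j , j<n , 0≤)))))

  candidate : ∀ n {{_ : NonZero n}} → Vec ℤ n → ℤ → ℤ
  candidate n d x = x + lookup d (fromℕ< (n%ℕd<d x n))

  candidates : ∀ n {{_ : NonZero n}} → ℕ → List (ℤ → ℤ)
  candidates n B = map (candidate n) (vectors n (interval B))

  module Reconstruction (n : ℕ) {{_ : NonZero n}} (ω : ℤ → ℤ) (affine : IsAffinePerm n ω) where

    open Displacement n ω affine

    residues : Vec ℤ n
    residues = tabulate (λ f → displacement (+ toℕ f))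

    ω-candidate : ∀ x → ω x ≡ candidate n residues x
    ω-candidate x = trans (displacement-residue x) (cong (λ d → x + d) (sym
      (trans (lookup∘tabulate _ (fromℕ< (n%ℕd<d x n)))
             (cong (λ t → displacement (+ t)) (Fin.toℕ-fromℕ< (n%ℕd<d x n))))))

    among-candidates : ∀ B →
                       (∀ j → j ℕ.< n → - (+ B) ≤ displacement (+ suc j) × displacement (+ suc j) ≤ + B) →
                       Any (λ g → ∀ x → ω x ≡ g x) (candidates n B)
    among-candidates B bounded =
      Any.map (λ { refl → ω-candidate }) (∈-map⁺ (candidate n) (vectors-complete n (interval B) residues entry))
      where
      at-residue : ∀ t → t ℕ.< n → displacement (+ t) ∈ interval B
      at-residue (suc j) 1+j<n with bounded j (ℕ.<-trans (ℕ.n<1+n j) 1+j<n)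
      ... | lower , upper = interval-complete B _ lower upper
      at-residue zero    _   = subst (_∈ interval B) shifted
                                 (interval-complete B _ (proj₁ last-bounded) (proj₂ last-bounded))
        where
        pred<n : ℕ.pred n ℕ.< n
        pred<n = subst (ℕ.pred n ℕ.<_) (ℕ.suc-pred n) ℕ.≤-refl
        last-bounded : - (+ B) ≤ displacement (+ suc (ℕ.pred n)) × displacement (+ suc (ℕ.pred n)) ≤ + B
        last-bounded = bounded (ℕ.pred n) pred<n
        one-period : + 0 + + 1 * + n ≡ + suc (ℕ.pred n)
        one-period = trans (ℤ.+-identityˡ _) (trans (ℤ.*-identityˡ (+ n)) (cong +_ (sym (ℕ.suc-pred n))))
        shifted : displacement (+ suc (ℕ.pred n)) ≡ displacement (+ 0)
        shifted = trans (cong displacement (sym one-period)) (displacement-periodic (+ 0) (+ 1))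
      entry : ∀ f → lookup residues f ∈ interval B
      entry f = subst (_∈ interval B) (sym (lookup∘tabulate _ f)) (at-residue (toℕ f) (Fin.toℕ<n f))

  -- An affine permutation avoiding p has displacements in [-B, B], B = bound*n + n:
  -- a larger spread between two residues yields two nearby positions whose
  -- values are far apart in the wrong order, hence an occurrence of p.
  module Avoiders (n : ℕ) {{_ : NonZero n}} {m} (p : Permutation′ m) (avoids321 : Avoids321 p) where

    open LeftToRightMaxima p avoids321 using (bound)

    B : ℕ
    B = bound ℕ.* n ℕ.+ n

    module _ (ω : ℤ → ℤ) (affine : IsAffinePerm n ω) (avoids : Avoids ω p) where

      open Displacement n ω affine
      open TwoStrands n ω affine p avoids321 using (far-apart⇒contains)

      no-drop : ∀ x {r} → r ℕ.< n → ¬ (+ B < displacement x - displacement (x + + r))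
      no-drop x {r} r<n drop = avoids (far-apart⇒contains x r<n ∣ G ∣ far gap)
        where
        G : ℤ
        G = ω x - ω (x + + r)
        difference : + r + G ≡ displacement x - displacement (x + + r)
        difference = shuffle (ω x) (ω (x + + r)) x (+ r)
          where
          shuffle : ∀ a b x r → r + (a - b) ≡ (a - x) - (b - (x + r))
          shuffle = solve-∀
        slack : + r + + (bound ℕ.* n) ≤ + B
        slack = subst (_≤ + B) (ℤ.pos-+ r (bound ℕ.* n))
          (+≤+ (subst (ℕ._≤ B) (ℕ.+-comm (bound ℕ.* n) r) (ℕ.+-monoʳ-≤ (bound ℕ.* n) (ℕ.<⇒≤ r<n))))
        G-large : + (bound ℕ.* n) < G
        G-large = +-reflectˡ-< (+ r) (ℤ.≤-<-trans slack (subst (+ B <_) (sym difference) drop))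
        G-exact : + ∣ G ∣ ≡ G
        G-exact = ℤ.0≤i⇒+∣i∣≡i (ℤ.<⇒≤ (ℤ.≤-<-trans (+≤+ ℕ.z≤n) G-large))
        far : bound ℕ.* n ℕ.< ∣ G ∣
        far = ℤ.drop‿+<+ (subst (+ (bound ℕ.* n) <_) (sym G-exact) G-large)
        gap : ω x ≡ ω (x + + r) + + ∣ G ∣
        gap = trans (sym (restore (ω x) (ω (x + + r)))) (cong (λ d → ω (x + + r) + d) (sym G-exact))
          where
          restore : ∀ a b → b + (a - b) ≡ a
          restore = solve-∀

      no-drop-to : ∀ a c {r} → r ℕ.< n → a ℕ.+ r ≡ c → ¬ (+ B < displacement (+ a) - displacement (+ c))
      no-drop-to a c {r} r<n a+r≡c =
        subst (λ y → ¬ (+ B < displacement (+ a) - displacement y))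
              (trans (sym (ℤ.pos-+ a r)) (cong +_ a+r≡c)) (no-drop (+ a) r<n)

      -- hence displacements at two residues 1 … n differ by at most B (if the
      -- earlier residue is the higher one, compare with the next period instead)
      residues-close : ∀ {a b} → a ℕ.< n → b ℕ.< n → ¬ (+ B < displacement (+ suc a) - displacement (+ suc b))
      residues-close {a} {b} a<n b<n with ℕ.<-cmp a b
      ... | tri< a<b _ _ = no-drop-to (suc a) (suc b) (ℕ.≤-<-trans (ℕ.m∸n≤m b a) b<n)
                             (ℕ.m+[n∸m]≡n (ℕ.m≤n⇒m≤1+n a<b))
      ... | tri≈ _ refl _ = λ drop →
        ℕ.n≮0 (ℤ.drop‿+<+ (subst (+ B <_) (ℤ.+-inverseʳ (displacement (+ suc a))) drop))
      ... | tri> _ _ b<a = λ drop → no-drop-to (suc a) (suc b ℕ.+ n) r<n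
                             (ℕ.m+[n∸m]≡n (ℕ.≤-trans a<n (ℕ.m≤n+m n (suc b))))
                             (subst (λ d → + B < displacement (+ suc a) - d) (sym next-period) drop)
        where
        r<n : suc b ℕ.+ n ℕ.∸ suc a ℕ.< n
        r<n = ℕ.m<n+o⇒m∸n<o (suc b ℕ.+ n) (suc a) (ℕ.+-monoˡ-< n (ℕ.s<s b<a))
        next-period : displacement (+ (suc b ℕ.+ n)) ≡ displacement (+ suc b)
        next-period = trans (cong displacement (trans (ℤ.pos-+ (suc b) n)
                              (cong (λ t → + suc b + t) (sym (ℤ.*-identityˡ (+ n))))))
                            (displacement-periodic (+ suc b) (+ 1))

      -- a displacement > B (< -B) would be far above (below) one that is ≤ 0 (≥ 0)
      displacement-bounded : ∀ j → j ℕ.< n → - (+ B) ≤ displacement (+ suc j) × displacement (+ suc j) ≤ + B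
      displacement-bounded j j<n = from-below , from-above
        where
        from-above : displacement (+ suc j) ≤ + B
        from-above with displacement (+ suc j) ≤? + B
        ... | yes ≤B = ≤B
        ... | no  ≰B with nonpositive-somewhere
        ...   | s , s<n , ≤0 = ⊥-elim (residues-close j<n s<n (ℤ.<-≤-trans (ℤ.≰⇒> ≰B)
                  (ℤ.≤-trans (ℤ.≤-reflexive (sym (ℤ.+-identityʳ (displacement (+ suc j)))))
                    (ℤ.+-monoʳ-≤ (displacement (+ suc j)) (ℤ.neg-mono-≤ ≤0)))))
        from-below : - (+ B) ≤ displacement (+ suc j)
        from-below with - (+ B) ≤? displacement (+ suc j)
        ... | yes ≥-B = ≥-B
        ... | no  ≱-B with nonnegative-somewhere
        ...   | s , s<n , 0≤ = ⊥-elim (residues-close s<n j<n (ℤ.<-≤-trans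
                  (subst (_< - displacement (+ suc j)) (ℤ.neg-involutive (+ B)) (ℤ.neg-mono-< (ℤ.≰⇒> ≱-B)))
                  (ℤ.≤-trans (ℤ.≤-reflexive (sym (ℤ.+-identityˡ (- displacement (+ suc j)))))
                    (ℤ.+-monoˡ-≤ (- displacement (+ suc j)) 0≤))))

    avoiders-finite : FiniteFunSet (λ ω → IsAffinePerm n ω × Avoids ω p)
    avoiders-finite = candidates n B , λ ω (affine , avoids) →
      Reconstruction.among-candidates n ω affine B (displacement-bounded ω affine avoids)

-- the argument only needs n ≥ 1
proposition3p3 : (n : ℕ) → n ≥ 2 → (m : ℕ) → (p : Permutation′ m) → Avoids321 p →
    FiniteFunSet (λ ω → IsAffinePerm n ω × Avoids ω p)
proposition3p3 n n≥2 m p avoids321 = Finiteness.Avoiders.avoiders-finite n {{n≢0}} p avoids321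
  where
  n≢0 : NonZero n
  n≢0 = >-nonZero (<-≤-trans z<s n≥2)
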